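{- Let $n\ge 2$ and let $t\ge 0$ be an integer with $r_t=1$. Then $\mathcal{L}_t=\{x_1^{t+1}\partial_n\}$.
   Context: Let $n\ge 2$ be an integer. A partition is a sequence $\Lambda=(\lambda_s)_{s\ge 1}$ of non-negative integers with finite support; $\mathrm{wt}(\Lambda)=\sum_s s\lambda_s$; $x^\Lambda=\prod_s x_s^{\lambda_s}$ (monomial in commuting indeterminates), $\deg(x^\Lambda)=\sum_s\lambda_s$. $\mathrm{Part}(j)$ is the set of partitions with $\lambda_s=0$ for $s>j$; $\partial_k$ is the partial derivative with respect to $x_k$. Let $\mathcal{B}=\{x^\Lambda\partial_k:1\le k\le n,\ \Lambda\in\mathrm{Part}(k-1)\}$. For an integer $i\ge -1$ let $r_i\in\{1,\dots,n-1\}$ with $i\equiv r_i\pmod{n-1}$ and $h_i=\lfloor (i-1)/(n-1)\rfloor+1$. For $x^\Lambda\partial_k\in\mathcal{B}$ define $\mathrm{WD}(x^\Lambda\partial_k)=\mathrm{wt}(\Lambda)-\deg(x^\Lambda)+n-k$ and $\mathrm{lev}_i(x^\Lambda\partial_k)=h_i\,\mathrm{WD}(x^\Lambda\partial_k)+\deg(x^\Lambda)-1$. For $i\ge -1$ let $\mathcal{N}_i=\{b\in\mathcal{B}: \mathrm{lev}_j(b)\le j \text{ for some integer } j \text{ with } -1\le j\le i\}$, and for $i\ge 0$ let $\mathcal{L}_i=\mathcal{N}_i\setminus\mathcal{N}_{i-1}$. -}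

module Defs where

open import Data.Nat as ℕ using (ℕ; zero; suc; _∸_)
open import Data.Integer as ℤ using (ℤ; +_; _+_; _-_; _*_; _≤_; -1ℤ; 1ℤ; _%ℕ_; _/ℕ_)
open import Data.List using (List; []; _∷_; length; replicate)
open import Data.Product using (Σ; _×_; ∃-syntax)
open import Relation.Nullary using (¬_)
open import Relation.Binary.PropositionalEquality using (_≡_)

-- A basis element  x^Λ ∂_k  of 𝓑 is encoded by the pair (k , Λ) where
-- Λ = [λ₁ , … , λ_{k-1}] lists the entries of a partition in Part(k-1)
-- (all entries beyond position k-1 are zero).
IsBasis : ℕ → ℕ → List ℕ → Set
IsBasis n k Λ = (1 ℕ.≤ k) × (k ℕ.≤ n) × (length Λ ≡ k ∸ 1)

wtFrom : ℕ → List ℕ → ℕ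
wtFrom s []       = 0
wtFrom s (l ∷ Λ)  = s ℕ.* l ℕ.+ wtFrom (suc s) Λ

wt : List ℕ → ℕ
wt Λ = wtFrom 1 Λ

deg : List ℕ → ℕ
deg []      = 0
deg (l ∷ Λ) = l ℕ.+ deg Λ

WD : ℕ → ℕ → List ℕ → ℤ
WD n k Λ = + wt Λ - + deg Λ + + n - + k

-- Throughout n ≥ 2, so n - 1 = suc (n ∸ 2); we divide by suc (n ∸ 2)
-- to have a syntactically non-zero divisor.
-- h_i = ⌊(i-1)/(n-1)⌋ + 1   (floor division; _/ℕ_ rounds towards -∞)
h : ℕ → ℤ → ℤ
h n i = ((i - 1ℤ) /ℕ suc (n ∸ 2)) + 1ℤ

r : ℕ → ℤ → ℤ
r n i = + ((i - 1ℤ) %ℕ suc (n ∸ 2)) + 1ℤ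

lev : ℕ → ℤ → ℕ → List ℕ → ℤ
lev n i k Λ = h n i * WD n k Λ + + deg Λ - 1ℤ

InN : ℕ → ℤ → ℕ → List ℕ → Set
InN n i k Λ = IsBasis n k Λ × (∃[ j ] (-1ℤ ≤ j × j ≤ i × lev n j k Λ ≤ j))

InL : ℕ → ℤ → ℕ → List ℕ → Set
InL n i k Λ = InN n i k Λ × ¬ InN n (i - 1ℤ) k Λ

x1pow∂n-k : ℕ → ℕ
x1pow∂n-k n = n

x1pow∂n-Λ : ℕ → ℕ → List ℕ
x1pow∂n-Λ n t = suc t ∷ replicate (n ∸ 2) 0

-- When r_t = 1 the floor quotient defining h steps up, h_t = h_{t-1} + 1, hence
-- lev_t = lev_{t-1} + WD.  An element of 𝓛_t satisfies lev_t ≤ t ≤ lev_{t-1}, so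
-- WD ≤ 0.  But WD = Σ_s (s-1) λ_s + (n - k) ≥ 0, so WD = 0: k = n and only λ₁ can be
-- non-zero.  Then lev_j = deg - 1 for every j, which pins deg = t + 1.  Conversely
-- x₁^{t+1} ∂ₙ has WD = 0, so all its levels equal t and it enters 𝓝 exactly at t.

module Submission where

open import Defs
open import Data.Nat using (ℕ; _≤_)
open import Data.Integer using (+_; 1ℤ)
open import Data.List using (List)
open import Data.Product using (_×_)
open import Function.Bundles using (_⇔_)
open import Relation.Binary.PropositionalEquality using (_≡_)

open import Data.Nat as ℕ using (zero; suc; _∸_; s≤s; z≤n)
import Data.Nat.Properties as ℕ
open import Data.Integer as ℤ using (0ℤ; -1ℤ; _+_; _-_; _*_; _%ℕ_; _/ℕ_; +≤+; +<+; -≤+)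
import Data.Integer.Properties as ℤ
open import Data.Integer.DivMod using (a≡a%ℕn+[a/ℕn]*n; n<s[n/ℕd]*d)
open import Data.Integer.Tactic.RingSolver using (solve-∀)
import Data.Nat.Tactic.RingSolver as ℕ-Solver
open import Data.List using ([]; _∷_; length; replicate)
open import Data.List.Properties using (length-replicate)
open import Data.Product using (_,_)
open import Function.Bundles using (mk⇔)
open import Relation.Nullary using (¬_)
open import Relation.Binary.PropositionalEquality
  using (refl; sym; trans; cong; cong₂; subst; subst₂; module ≡-Reasoning)

i≤j⇒j≰i-1 : ∀ {i j} → i ℤ.≤ j → ¬ (j ℤ.≤ i - 1ℤ)
i≤j⇒j≰i-1 {i} i≤j j≤i-1 =
  ℤ.≤⇒≯ i≤j (ℤ.i≤pred[j]⇒i<j (subst (_ ℤ.≤_) (ℤ.+-comm i -1ℤ) j≤i-1))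

j≰i-1⇒i≤j : ∀ {i j} → ¬ (j ℤ.≤ i - 1ℤ) → i ℤ.≤ j
j≰i-1⇒i≤j {i} j≰i-1 =
  ℤ.≮⇒≥ (λ j<i → j≰i-1 (subst (_ ℤ.≤_) (ℤ.+-comm -1ℤ i) (ℤ.i<j⇒i≤pred[j] j<i)))

i+j≤i⇒j≤0 : ∀ i j → i + j ℤ.≤ i → j ℤ.≤ 0ℤ
i+j≤i⇒j≤0 i j i+j≤i = subst (ℤ._≤ 0ℤ) (cancel i j) (ℤ.i≤j⇒i-j≤0 i+j≤i)
  where
  cancel : ∀ i j → (i + j) - i ≡ j
  cancel = solve-∀

quotient-≤ : ∀ {a q q'} m .{{_ : ℕ.NonZero m}} →
             q * + m ℤ.≤ a → a ℤ.< ℤ.suc q' * + m → q ℤ.≤ q'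
quotient-≤ {q' = q'} m@(suc _) qm≤a a<[q'+1]m =
  subst (_ ℤ.≤_) (ℤ.pred-suc q')
    (ℤ.i<j⇒i≤pred[j] {j = ℤ.suc q'} (ℤ.*-cancelʳ-<-nonNeg (+ m) (ℤ.≤-<-trans qm≤a a<[q'+1]m)))

/ℕ-unique : ∀ a m .{{_ : ℕ.NonZero m}} q ρ → ρ ℕ.< m →
            a ≡ + ρ + q * + m → a /ℕ m ≡ q
/ℕ-unique a m q ρ ρ<m a≡ =
  ℤ.≤-antisym (quotient-≤ m (lower (a %ℕ m) (a /ℕ m) (a≡a%ℕn+[a/ℕn]*n a m)) a<[q+1]m)
              (quotient-≤ m (lower ρ q a≡) (n<s[n/ℕd]*d a m))
  where
  lower : ∀ ρ q → a ≡ + ρ + q * + m → q * + m ℤ.≤ a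
  lower ρ q refl = ℤ.i≤j+i (q * + m) (+ ρ)
  a<[q+1]m : a ℤ.< ℤ.suc q * + m
  a<[q+1]m = subst₂ ℤ._<_ (sym a≡) (sym (ℤ.suc-* q (+ m))) (ℤ.+-monoˡ-< (q * + m) (+<+ ρ<m))

[a-1]/ℕm≡a/ℕm-1 : ∀ a m .{{_ : ℕ.NonZero m}} → a %ℕ m ≡ 0 → (a - 1ℤ) /ℕ m ≡ a /ℕ m - 1ℤ
[a-1]/ℕm≡a/ℕm-1 a m@(suc m-1) a%m≡0 =
  /ℕ-unique (a - 1ℤ) m (a /ℕ m - 1ℤ) m-1 ℕ.≤-refl (begin
    a - 1ℤ                                      ≡⟨ cong (_- 1ℤ) (a≡a%ℕn+[a/ℕn]*n a m) ⟩
    + (a %ℕ m) + a /ℕ m * + m - 1ℤ              ≡⟨ cong (λ ρ → + ρ + a /ℕ m * + m - 1ℤ) a%m≡0 ⟩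
    0ℤ + a /ℕ m * (1ℤ + + m-1) - 1ℤ             ≡⟨ borrow (a /ℕ m) (+ m-1) ⟩
    + m-1 + (a /ℕ m - 1ℤ) * (1ℤ + + m-1)        ∎)
  where
  open ≡-Reasoning
  borrow : ∀ q k → 0ℤ + q * (1ℤ + k) - 1ℤ ≡ k + (q - 1ℤ) * (1ℤ + k)
  borrow = solve-∀

h-suc : ∀ n i → r n i ≡ 1ℤ → h n i ≡ h n (i - 1ℤ) + 1ℤ
h-suc n i r≡1 = begin
  (i - 1ℤ) /ℕ m + 1ℤ              ≡⟨ sub-add ((i - 1ℤ) /ℕ m) ⟩
  ((i - 1ℤ) /ℕ m - 1ℤ) + 1ℤ + 1ℤ  ≡⟨ cong (λ q → q + 1ℤ + 1ℤ) (sym ([a-1]/ℕm≡a/ℕm-1 (i - 1ℤ) m [i-1]%m≡0)) ⟩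
  (i - 1ℤ - 1ℤ) /ℕ m + 1ℤ + 1ℤ    ∎
  where
  open ≡-Reasoning
  m : ℕ
  m = suc (n ∸ 2)
  [i-1]%m≡0 : (i - 1ℤ) %ℕ m ≡ 0
  [i-1]%m≡0 = ℕ.+-cancelʳ-≡ 1 _ 0 (ℤ.+-injective r≡1)
  sub-add : ∀ q → q + 1ℤ ≡ (q - 1ℤ) + 1ℤ + 1ℤ
  sub-add = solve-∀

lev-suc : ∀ n i k Λ → r n i ≡ 1ℤ → lev n i k Λ ≡ lev n (i - 1ℤ) k Λ + WD n k Λ
lev-suc n i k Λ r≡1 = begin
  h n i * WD n k Λ + + deg Λ - 1ℤ
    ≡⟨ cong (λ a → a * WD n k Λ + + deg Λ - 1ℤ) (h-suc n i r≡1) ⟩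
  (h n (i - 1ℤ) + 1ℤ) * WD n k Λ + + deg Λ - 1ℤ
    ≡⟨ distrib (h n (i - 1ℤ)) (WD n k Λ) (+ deg Λ) ⟩
  h n (i - 1ℤ) * WD n k Λ + + deg Λ - 1ℤ + WD n k Λ ∎
  where
  open ≡-Reasoning
  distrib : ∀ a w d → (a + 1ℤ) * w + d - 1ℤ ≡ a * w + d - 1ℤ + w
  distrib = solve-∀

wtFrom-suc : ∀ s Λ → wtFrom (suc s) Λ ≡ deg Λ ℕ.+ wtFrom s Λ
wtFrom-suc s []      = refl
wtFrom-suc s (l ∷ Λ) =
  trans (cong (suc s ℕ.* l ℕ.+_) (wtFrom-suc (suc s) Λ))
        (rearrange l (s ℕ.* l) (deg Λ) (wtFrom (suc s) Λ))
  where
  rearrange : ∀ a b c d → (a ℕ.+ b) ℕ.+ (c ℕ.+ d) ≡ (a ℕ.+ c) ℕ.+ (b ℕ.+ d)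
  rearrange = ℕ-Solver.solve-∀

WD≡+[wtFrom0+n∸k] : ∀ {n k} Λ → k ℕ.≤ n → WD n k Λ ≡ + (wtFrom 0 Λ ℕ.+ (n ∸ k))
WD≡+[wtFrom0+n∸k] {n} {k} Λ k≤n = begin
  + wt Λ - + deg Λ + + n - + k
    ≡⟨ cong₂ (λ w m → + w - + deg Λ + + m - + k) (wtFrom-suc 0 Λ) (sym (ℕ.m+[n∸m]≡n k≤n)) ⟩
  (+ deg Λ + + wtFrom 0 Λ) - + deg Λ + (+ k + + (n ∸ k)) - + k
    ≡⟨ cancel (+ deg Λ) (+ wtFrom 0 Λ) (+ k) (+ (n ∸ k)) ⟩
  + wtFrom 0 Λ + + (n ∸ k) ∎
  where
  open ≡-Reasoning
  cancel : ∀ d w k e → (d + w) - d + (k + e) - k ≡ w + e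
  cancel = solve-∀

WD≡0⇒wtFrom0≡0×k≡n : ∀ {n k} Λ → k ℕ.≤ n → WD n k Λ ≡ 0ℤ → wtFrom 0 Λ ≡ 0 × k ≡ n
WD≡0⇒wtFrom0≡0×k≡n {n} {k} Λ k≤n WD≡0 =
  ℕ.m+n≡0⇒m≡0 _ sum≡0 , ℕ.≤-antisym k≤n (ℕ.m∸n≡0⇒m≤n (ℕ.m+n≡0⇒n≡0 (wtFrom 0 Λ) sum≡0))
  where
  sum≡0 : wtFrom 0 Λ ℕ.+ (n ∸ k) ≡ 0
  sum≡0 = ℤ.+-injective (trans (sym (WD≡+[wtFrom0+n∸k] Λ k≤n)) WD≡0)

WD≡0⇒lev≡deg-1 : ∀ n j k Λ → WD n k Λ ≡ 0ℤ → lev n j k Λ ≡ + deg Λ - 1ℤ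
WD≡0⇒lev≡deg-1 n j k Λ WD≡0 = begin
  h n j * WD n k Λ + + deg Λ - 1ℤ   ≡⟨ cong (λ w → h n j * w + + deg Λ - 1ℤ) WD≡0 ⟩
  h n j * 0ℤ + + deg Λ - 1ℤ         ≡⟨ cong (λ x → x + + deg Λ - 1ℤ) (ℤ.*-zeroʳ (h n j)) ⟩
  + deg Λ - 1ℤ                      ∎
  where open ≡-Reasoning

deg≡0⇒≡replicate : ∀ Λ → deg Λ ≡ 0 → Λ ≡ replicate (length Λ) 0
deg≡0⇒≡replicate []      _      = refl
deg≡0⇒≡replicate (l ∷ Λ) deg≡0 =
  cong₂ _∷_ (ℕ.m+n≡0⇒m≡0 l deg≡0) (deg≡0⇒≡replicate Λ (ℕ.m+n≡0⇒n≡0 l deg≡0))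

wtFrom0≡0⇒≡deg∷replicate : ∀ {m} Λ → length Λ ≡ suc m → wtFrom 0 Λ ≡ 0 →
                           Λ ≡ deg Λ ∷ replicate m 0
wtFrom0≡0⇒≡deg∷replicate (l ∷ Λ) refl wt≡0 =
  cong₂ _∷_ (sym (trans (cong (l ℕ.+_) degΛ≡0) (ℕ.+-identityʳ l))) (deg≡0⇒≡replicate Λ degΛ≡0)
  where
  degΛ≡0 : deg Λ ≡ 0
  degΛ≡0 = ℕ.m+n≡0⇒m≡0 (deg Λ) (trans (sym (wtFrom-suc 0 Λ)) wt≡0)

deg-replicate-0 : ∀ m → deg (replicate m 0) ≡ 0
deg-replicate-0 zero    = refl
deg-replicate-0 (suc m) = deg-replicate-0 m

wtFrom-replicate-0 : ∀ s m → wtFrom s (replicate m 0) ≡ 0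
wtFrom-replicate-0 s zero    = refl
wtFrom-replicate-0 s (suc m) =
  trans (cong (ℕ._+ wtFrom (suc s) (replicate m 0)) (ℕ.*-zeroʳ s)) (wtFrom-replicate-0 (suc s) m)

InL⇒lev-bounds : ∀ {n i k Λ} → -1ℤ ℤ.≤ i - 1ℤ → InL n i k Λ →
                 IsBasis n k Λ × lev n i k Λ ℤ.≤ i × i ℤ.≤ lev n (i - 1ℤ) k Λ
InL⇒lev-bounds {n} {i} {k} {Λ} -1≤i-1 ((basis , j , -1≤j , j≤i , levj≤j) , ∉N[i-1]) =
  basis ,
  subst (λ j → lev n j k Λ ℤ.≤ j) j≡i levj≤j ,
  j≰i-1⇒i≤j (λ lev≤i-1 → ∉N[i-1] (basis , i - 1ℤ , -1≤i-1 , ℤ.≤-refl , lev≤i-1))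
  where
  j≡i : j ≡ i
  j≡i = ℤ.≤-antisym j≤i (j≰i-1⇒i≤j (λ j≤i-1 → ∉N[i-1] (basis , j , -1≤j , j≤i-1 , levj≤j)))

lev≡i⇒InL : ∀ {n i k Λ} → IsBasis n k Λ → -1ℤ ℤ.≤ i → (∀ j → lev n j k Λ ≡ i) → InL n i k Λ
lev≡i⇒InL {i = i} basis -1≤i lev≡i =
  (basis , i , -1≤i , ℤ.≤-refl , ℤ.≤-reflexive (lev≡i i)) ,
  λ (_ , j , _ , j≤i-1 , levj≤j) → i≤j⇒j≰i-1 (subst (ℤ._≤ j) (lev≡i j) levj≤j) j≤i-1

lev-bounds⇒WD≡0 : ∀ {n i k Λ} → r n i ≡ 1ℤ → k ℕ.≤ n →
                  lev n i k Λ ℤ.≤ i → i ℤ.≤ lev n (i - 1ℤ) k Λ → WD n k Λ ≡ 0ℤ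
lev-bounds⇒WD≡0 {n} {i} {k} {Λ} r≡1 k≤n levi≤i i≤lev[i-1] = ℤ.≤-antisym WD≤0 0≤WD
  where
  WD≤0 : WD n k Λ ℤ.≤ 0ℤ
  WD≤0 = i+j≤i⇒j≤0 (lev n (i - 1ℤ) k Λ) (WD n k Λ)
           (ℤ.≤-trans (subst (ℤ._≤ i) (lev-suc n i k Λ r≡1) levi≤i) i≤lev[i-1])
  0≤WD : 0ℤ ℤ.≤ WD n k Λ
  0≤WD = subst (0ℤ ℤ.≤_) (sym (WD≡+[wtFrom0+n∸k] Λ k≤n)) (+≤+ z≤n)

+m-1≡+n⇒m≡1+n : ∀ m n → + m - 1ℤ ≡ + n → m ≡ suc n
+m-1≡+n⇒m≡1+n m n m-1≡n =
  trans (ℤ.+-injective (trans (sub-add (+ m)) (cong (_+ 1ℤ) m-1≡n))) (ℕ.+-comm n 1)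
  where
  sub-add : ∀ a → a ≡ a - 1ℤ + 1ℤ
  sub-add = solve-∀

x1pow∂n∈L : ∀ n t → 2 ≤ n → InL n (+ t) n (suc t ∷ replicate (n ∸ 2) 0)
x1pow∂n∈L n@(suc (suc n-2)) t (s≤s (s≤s _)) =
  lev≡i⇒InL {n} {+ t} {n} {Λ} (s≤s z≤n , ℕ.≤-refl , cong suc (length-replicate n-2)) -≤+ lev≡t
  where
  Λ : List ℕ
  Λ = suc t ∷ replicate n-2 0
  deg≡1+t : deg Λ ≡ suc t
  deg≡1+t = trans (cong (suc t ℕ.+_) (deg-replicate-0 n-2)) (ℕ.+-identityʳ (suc t))
  WD≡0 : WD n n Λ ≡ 0ℤ
  WD≡0 = trans (WD≡+[wtFrom0+n∸k] Λ ℕ.≤-refl)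
               (cong₂ (λ w e → + (w ℕ.+ e)) (wtFrom-replicate-0 1 n-2) (ℕ.n∸n≡0 n))
  lev≡t : ∀ j → lev n j n Λ ≡ + t
  lev≡t j = trans (WD≡0⇒lev≡deg-1 n j n Λ WD≡0)
                  (cong (λ d → + d - 1ℤ) deg≡1+t)

InL⇒≡x1pow∂n : ∀ {n t k Λ} → 2 ≤ n → r n (+ t) ≡ 1ℤ → InL n (+ t) k Λ →
               k ≡ n × Λ ≡ suc t ∷ replicate (n ∸ 2) 0
InL⇒≡x1pow∂n {n@(suc (suc _))} {t} {k} {Λ} (s≤s (s≤s _)) r≡1 inL
  with (_ , k≤n , length≡k-1) , levt≤t , t≤lev[t-1]
         ← InL⇒lev-bounds {n} {+ t} {k} {Λ} (ℤ.+-monoˡ-≤ -1ℤ (+≤+ {0} {t} z≤n)) inL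
  with WD≡0 ← lev-bounds⇒WD≡0 {n} {+ t} {k} {Λ} r≡1 k≤n levt≤t t≤lev[t-1]
  with wt≡0 , refl ← WD≡0⇒wtFrom0≡0×k≡n Λ k≤n WD≡0 =
  refl , trans (wtFrom0≡0⇒≡deg∷replicate Λ length≡k-1 wt≡0) (cong (_∷ replicate _ 0) deg≡1+t)
  where
  deg≡1+t : deg Λ ≡ suc t
  deg≡1+t = +m-1≡+n⇒m≡1+n (deg Λ) t (ℤ.≤-antisym
    (subst (ℤ._≤ + t) (WD≡0⇒lev≡deg-1 n (+ t) n Λ WD≡0) levt≤t)
    (subst (+ t ℤ.≤_) (WD≡0⇒lev≡deg-1 n (+ t - 1ℤ) n Λ WD≡0) t≤lev[t-1]))

corollary2p10 : (n : ℕ) → 2 ≤ n → (t : ℕ) → r n (+ t) ≡ 1ℤ →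
    (k : ℕ) (Λ : List ℕ) →
    InL n (+ t) k Λ ⇔ (k ≡ x1pow∂n-k n × Λ ≡ x1pow∂n-Λ n t)
corollary2p10 n 2≤n t r≡1 k Λ =
  mk⇔ (InL⇒≡x1pow∂n 2≤n r≡1) λ { (refl , refl) → x1pow∂n∈L n t 2≤n }
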